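{- Let $B$ be a binary doubly even $[36,7]$ code (a $7$-dimensional subspace of $\mathbb{F}_2^{36}$ in which every codeword has Hamming weight divisible by $4$) such that the minimum weight of $B$ is at least $16$ and the minimum weight of its dual code $B^\perp$ is at least $4$. Then the weight enumerator of $B$ is $1+63y^{16}+63y^{20}+y^{36}$.
   Context: The dual code is $B^\perp=\{x\in\mathbb{F}_2^{36}: x\cdot c=0 \text{ for all } c\in B\}$ under the standard inner product. The weight enumerator of $B$ is $\sum_{c\in B} y^{\mathrm{wt}(c)}$, where $\mathrm{wt}$ is the Hamming weight. -}

module Defs where

open import Data.Bool using (Bool; true; false; _xor_; _∧_; if_then_else_)
open import Data.Nat using (ℕ; zero; suc; _+_; _*_; _≡ᵇ_)
open import Data.Vec using (Vec; []; _∷_; replicate; zipWith; foldr)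
open import Data.List using (List; []; _∷_; map; _++_; length; filter)
open import Data.Nat.Properties using (_≟_)
open import Relation.Binary.PropositionalEquality using (_≡_)

-- F₂ is modelled by Bool: addition = xor, multiplication = ∧.
-- A word of length n over F₂.
Word : ℕ → Set
Word n = Vec Bool n

wt : ∀ {n} → Word n → ℕ
wt [] = 0
wt (true ∷ xs) = suc (wt xs)
wt (false ∷ xs) = wt xs

0w : ∀ n → Word n
0w n = replicate n false

_⊕_ : ∀ {n} → Word n → Word n → Word n
_⊕_ = zipWith _xor_

_·_ : ∀ {n} → Word n → Word n → Bool
x · y = foldr _ _xor_ false (zipWith _∧_ x y)

_⊙_ : ∀ {n} → Bool → Word n → Word n
b ⊙ x = Data.Vec.map (b ∧_) x

-- A linear code of dimension k is given by a generator matrix G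
-- (k rows, each a word of length n); its codewords are the F₂-linear
-- combinations  m·G  of the rows, m ∈ F₂^k.
Generator : ℕ → ℕ → Set
Generator k n = Vec (Word n) k

encode : ∀ {k n} → Generator k n → Word k → Word n
encode {n = n} [] [] = 0w n
encode (g ∷ G) (b ∷ m) = (b ⊙ g) ⊕ encode G m

_∈C_ : ∀ {k n} → Word n → Generator k n → Set
_∈C_ {k} x G = Data.Product.Σ (Word k) (λ m → encode G m ≡ x)
  where import Data.Product

-- The rows of G are linearly independent, i.e. the code has dimension
-- exactly k (the encoding map F₂^k → B is a bijection).
LinIndep : ∀ {k n} → Generator k n → Set
LinIndep {k} G = (m m′ : Word k) → encode G m ≡ encode G m′ → m ≡ m′

allWords : (k : ℕ) → List (Word k)
allWords zero = [] ∷ []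
allWords (suc k) = map (false ∷_) (allWords k) ++ map (true ∷_) (allWords k)

-- Coefficient of y^i in the weight enumerator Σ_{c∈B} y^{wt c}
-- (for LinIndep G every codeword arises from exactly one message).
weightEnumCoeff : ∀ {k n} → Generator k n → ℕ → ℕ
weightEnumCoeff {k} G i = length (filter (λ m → wt (encode G m) ≟ i) (allWords k))

targetCoeff : ℕ → ℕ
targetCoeff i =
  if i ≡ᵇ 0 then 1 else
  if i ≡ᵇ 16 then 63 else
  if i ≡ᵇ 20 then 63 else
  if i ≡ᵇ 36 then 1 else 0

module Submission where

-- For a codeword c write bias c = Σⱼ (-1)^cⱼ = 36 - 2 wt c.  Expanding powers of the bias
-- into characters x ↦ (-1)^(x·c) of words x of weight at most 3, orthogonality of
-- characters over F₂⁷ and the absence of nonzero dual words of weight ≤ 3 give the power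
-- moments Σ_c bias c ^ r = 128, 0, 36·128, 0 for r = 0, 1, 2, 3.  The cubic
-- P(u) = (u + 36)(u - 4)(u + 4) is nonnegative at the bias of every weight allowed by the
-- hypotheses (0, 16, 20, 24, 28, 32, 36) and vanishes there only at weights 16, 20, 36;
-- its moment sum Σ_c P(bias c) = 92160 is already the contribution P(36) of the zero
-- codeword, so every codeword has weight 0, 16, 20 or 36.  The four weight counts are then
-- read off from the four moments by Lagrange interpolation at u = 36, 4, -4, -36.

open import Defs
open import Data.Nat using (ℕ; _≤_)
open import Data.Nat.Divisibility using (_∣_)
open import Data.Bool using (false)
open import Relation.Binary.PropositionalEquality using (_≡_)
open import Relation.Nullary using (¬_)

open import Algebra.Bundles using (AbelianGroup; CommutativeRing)
open import Data.Bool using (Bool; true; not; _xor_; _∧_; if_then_else_)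
open import Data.Bool.Properties using (xor-∧-commutativeRing; ∧-distribˡ-xor; ∧-comm; xor-identityʳ)
import Data.Bool.Properties as Bool
open import Data.Fin using (Fin; zero; suc; toℕ; fromℕ<; punchIn)
open import Data.Fin.Properties using (punchInᵢ≢i; toℕ-fromℕ<)
import Data.Fin.Properties as Fin
open import Data.Integer using (ℤ; +_; -_; _+_; _-_; _*_; 0ℤ; 1ℤ; -1ℤ)
import Data.Integer as ℤ
import Data.Integer.Properties as ℤ
open import Data.Integer.Tactic.RingSolver using (solve-∀)
open import Data.List using (List; []; _∷_; _++_; map; length; filter)
open import Data.List.Properties using (length-++; length-map; filter-none)
open import Data.List.Membership.Propositional using (_∈_; _∉_)
open import Data.List.Relation.Unary.All as All using (All; []; _∷_)
open import Data.List.Relation.Unary.Any using (here; there)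
open import Data.Nat as ℕ using (zero; suc)
import Data.Nat.Properties as ℕ
open import Data.List.Membership.DecPropositional ℕ._≟_ using (_∈?_)
open import Data.Nat.Divisibility using (_∣?_)
open import Data.Product using (∃; _,_)
open import Data.Vec as Vec using ([]; _∷_; lookup; replicate; _[_]≔_)
import Data.Vec.Properties as Vec
open import Function using (_∘_)
open import Relation.Binary.PropositionalEquality
  using (_≢_; refl; sym; trans; cong; cong₂; subst; subst₂; ≢-sym; module ≡-Reasoning)
open import Relation.Nullary using (yes; no; contradiction)
open import Relation.Nullary.Decidable using (from-yes; dec-false; _→-dec_)

open import Algebra.Properties.CommutativeSemigroup
  (CommutativeRing.+-commutativeSemigroup xor-∧-commutativeRing) using (interchange)
open import Algebra.Properties.Group (AbelianGroup.group ℤ.+-0-abelianGroup)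
  using (identityʳ-unique)
open import Algebra.Properties.Semiring.Sum ℤ.+-*-semiring
  using (sum; sum-syntax; sum-cong-≗; ∑-distrib-+; sum-remove; sum-replicate-zero;
         *-distribˡ-sum; *-distribʳ-sum)

open ≡-Reasoning

private
  variable
    k n : ℕ

·-comm : (x y : Word n) → x · y ≡ y · x
·-comm []      []      = refl
·-comm (a ∷ x) (b ∷ y) = cong₂ _xor_ (∧-comm a b) (·-comm x y)

·-zeroˡ : (x : Word n) → 0w n · x ≡ false
·-zeroˡ []      = refl
·-zeroˡ (_ ∷ x) = ·-zeroˡ x

·-zeroʳ : (x : Word n) → x · 0w n ≡ false
·-zeroʳ x = trans (·-comm x _) (·-zeroˡ x)

·-distribˡ-⊕ : (x y z : Word n) → x · (y ⊕ z) ≡ (x · y) xor (x · z)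
·-distribˡ-⊕ []      []      []      = refl
·-distribˡ-⊕ (a ∷ x) (b ∷ y) (c ∷ z) = begin
  (a ∧ (b xor c)) xor (x · (y ⊕ z))
    ≡⟨ cong₂ _xor_ (∧-distribˡ-xor a b c) (·-distribˡ-⊕ x y z) ⟩
  ((a ∧ b) xor (a ∧ c)) xor ((x · y) xor (x · z))
    ≡⟨ interchange (a ∧ b) (a ∧ c) (x · y) (x · z) ⟩
  ((a ∧ b) xor (x · y)) xor ((a ∧ c) xor (x · z))
    ∎

·-distribʳ-⊕ : (x y z : Word n) → (x ⊕ y) · z ≡ (x · z) xor (y · z)
·-distribʳ-⊕ x y z = begin
  (x ⊕ y) · z             ≡⟨ ·-comm (x ⊕ y) z ⟩
  z · (x ⊕ y)             ≡⟨ ·-distribˡ-⊕ z x y ⟩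
  (z · x) xor (z · y)     ≡⟨ cong₂ _xor_ (·-comm z x) (·-comm z y) ⟩
  (x · z) xor (y · z)     ∎

false⊙ : (x : Word n) → false ⊙ x ≡ 0w n
false⊙ []      = refl
false⊙ (_ ∷ x) = cong (false ∷_) (false⊙ x)

·-⊙ : ∀ b (x y : Word n) → x · (b ⊙ y) ≡ b ∧ (x · y)
·-⊙ true  x y = cong (x ·_) (Vec.map-id y)
·-⊙ false x y = trans (cong (x ·_) (false⊙ y)) (·-zeroʳ x)

⊕-self : (x : Word n) → x ⊕ x ≡ 0w n
⊕-self []      = refl
⊕-self (a ∷ x) = cong₂ _∷_ (Bool.xor-same a) (⊕-self x)

encode-0 : (G : Generator k n) → encode G (0w k) ≡ 0w n
encode-0 []      = refl
encode-0 (g ∷ G) = trans (cong₂ _⊕_ (false⊙ g) (encode-0 G)) (⊕-self (0w _))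

_∈C⊥_ : Word n → Generator k n → Set
x ∈C⊥ G = ∀ c → c ∈C G → x · c ≡ false

-- G xᵀ: x lies in the dual code exactly when this vanishes.
syndrome : Generator k n → Word n → Word k
syndrome G x = Vec.map (x ·_) G

·-encode : (G : Generator k n) (x : Word n) (m : Word k) →
           x · encode G m ≡ m · syndrome G x
·-encode []      x []      = ·-zeroʳ x
·-encode (g ∷ G) x (b ∷ m) = begin
  x · ((b ⊙ g) ⊕ encode G m)             ≡⟨ ·-distribˡ-⊕ x (b ⊙ g) (encode G m) ⟩
  (x · (b ⊙ g)) xor (x · encode G m)     ≡⟨ cong₂ _xor_ (·-⊙ b x g) (·-encode G x m) ⟩
  (b ∧ (x · g)) xor (m · syndrome G x)   ∎

syndrome≡0⇒∈C⊥ : (G : Generator k n) (x : Word n) → syndrome G x ≡ 0w k → x ∈C⊥ G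
syndrome≡0⇒∈C⊥ G x Gx≡0 _ (m , refl) = begin
  x · encode G m     ≡⟨ ·-encode G x m ⟩
  m · syndrome G x   ≡⟨ cong (m ·_) Gx≡0 ⟩
  m · 0w _           ≡⟨ ·-zeroʳ m ⟩
  false              ∎

wt-0w : ∀ n → wt (0w n) ≡ 0
wt-0w zero    = refl
wt-0w (suc n) = wt-0w n

wt-≤ : (x : Word n) → wt x ≤ n
wt-≤ []          = ℕ.z≤n
wt-≤ (true ∷ x)  = ℕ.s≤s (wt-≤ x)
wt-≤ (false ∷ x) = ℕ.m≤n⇒m≤1+n (wt-≤ x)

wt-⊕ : (x y : Word n) → wt (x ⊕ y) ≤ wt x ℕ.+ wt y
wt-⊕ []          []          = ℕ.z≤n
wt-⊕ (false ∷ x) (false ∷ y) = wt-⊕ x y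
wt-⊕ (false ∷ x) (true ∷ y)  =
  subst (suc (wt (x ⊕ y)) ≤_) (sym (ℕ.+-suc (wt x) (wt y))) (ℕ.s≤s (wt-⊕ x y))
wt-⊕ (true ∷ x)  (false ∷ y) = ℕ.s≤s (wt-⊕ x y)
wt-⊕ (true ∷ x)  (true ∷ y)  =
  ℕ.m≤n⇒m≤1+n (ℕ.≤-trans (wt-⊕ x y) (ℕ.+-monoʳ-≤ (wt x) (ℕ.n≤1+n (wt y))))

e : Fin n → Word n
e {n} j = 0w n [ j ]≔ true

𝟙 : ∀ n → Word n
𝟙 n = replicate n true

wt-e : (j : Fin n) → wt (e j) ≡ 1
wt-e {suc n} zero = cong suc (wt-0w n)
wt-e (suc j)      = wt-e j

e-· : (j : Fin n) (c : Word n) → e j · c ≡ lookup c j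
e-· zero    (c ∷ cs) = trans (cong (c xor_) (·-zeroˡ cs)) (xor-identityʳ c)
e-· (suc j) (_ ∷ cs) = e-· j cs

lookup≡true⇒≢0 : {x : Word n} (j : Fin n) → lookup x j ≡ true → x ≢ 0w n
lookup≡true⇒≢0 j xⱼ refl = contradiction (trans (sym xⱼ) (Vec.lookup-replicate j false)) λ ()

·𝟙≡true⇒≢0 : {x : Word n} → x · 𝟙 n ≡ true → x ≢ 0w n
·𝟙≡true⇒≢0 {n} x·𝟙 refl = contradiction (trans (sym x·𝟙) (·-zeroˡ (𝟙 n))) λ ()

e·𝟙 : (j : Fin n) → e j · 𝟙 n ≡ true
e·𝟙 j = trans (e-· j (𝟙 _)) (Vec.lookup-replicate j true)

e≢0 : (j : Fin n) → e j ≢ 0w n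
e≢0 j = ·𝟙≡true⇒≢0 (e·𝟙 j)

e⊕e≢0 : {j l : Fin n} → j ≢ l → e j ⊕ e l ≢ 0w n
e⊕e≢0 {j = j} {l} j≢l = lookup≡true⇒≢0 j (begin
  lookup (e j ⊕ e l) j                 ≡⟨ Vec.lookup-zipWith _xor_ j (e j) (e l) ⟩
  lookup (e j) j xor lookup (e l) j    ≡⟨ cong₂ _xor_ (Vec.lookup∘update j (0w _) true)
                                                      (Vec.lookup∘update′ j≢l (0w _) true) ⟩
  true xor lookup (0w _) j             ≡⟨ cong not (Vec.lookup-replicate j false) ⟩
  true                                 ∎)

e⊕e⊕e≢0 : (i j l : Fin n) → (e i ⊕ e j) ⊕ e l ≢ 0w n
e⊕e⊕e≢0 i j l = ·𝟙≡true⇒≢0 (begin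
  ((e i ⊕ e j) ⊕ e l) · 𝟙 _
    ≡⟨ ·-distribʳ-⊕ (e i ⊕ e j) (e l) (𝟙 _) ⟩
  ((e i ⊕ e j) · 𝟙 _) xor (e l · 𝟙 _)
    ≡⟨ cong₂ _xor_ (·-distribʳ-⊕ (e i) (e j) (𝟙 _)) (e·𝟙 l) ⟩
  ((e i · 𝟙 _) xor (e j · 𝟙 _)) xor true
    ≡⟨ cong₂ (λ a b → (a xor b) xor true) (e·𝟙 i) (e·𝟙 j) ⟩
  true
    ∎)

wt-e⊕e : (j l : Fin n) → wt (e j ⊕ e l) ≤ 2
wt-e⊕e j l = ℕ.≤-trans (wt-⊕ (e j) (e l)) (ℕ.≤-reflexive (cong₂ ℕ._+_ (wt-e j) (wt-e l)))

wt-e⊕e⊕e : (i j l : Fin n) → wt ((e i ⊕ e j) ⊕ e l) ≤ 3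
wt-e⊕e⊕e i j l = ℕ.≤-trans (wt-⊕ (e i ⊕ e j) (e l)) (ℕ.+-mono-≤ (wt-e⊕e i j) (ℕ.≤-reflexive (wt-e l)))

sumOver : {A : Set} → List A → (A → ℤ) → ℤ
sumOver []       f = 0ℤ
sumOver (x ∷ xs) f = f x + sumOver xs f

infixl 10 sumOver
syntax sumOver xs (λ x → e) = ∑[ x ∈ xs ] e

module _ {A : Set} where

  ∑-cong : {f g : A → ℤ} (xs : List A) → (∀ x → f x ≡ g x) → ∑[ x ∈ xs ] f x ≡ ∑[ x ∈ xs ] g x
  ∑-cong []       f≗g = refl
  ∑-cong (x ∷ xs) f≗g = cong₂ _+_ (f≗g x) (∑-cong xs f≗g)

  ∑-cong-All : {f g : A → ℤ} {xs : List A} → All (λ x → f x ≡ g x) xs →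
               ∑[ x ∈ xs ] f x ≡ ∑[ x ∈ xs ] g x
  ∑-cong-All []         = refl
  ∑-cong-All (fx≡gx ∷ p) = cong₂ _+_ fx≡gx (∑-cong-All p)

  ∑-++ : (f : A → ℤ) (xs ys : List A) →
         ∑[ x ∈ xs ++ ys ] f x ≡ ∑[ x ∈ xs ] f x + ∑[ x ∈ ys ] f x
  ∑-++ f []       ys = sym (ℤ.+-identityˡ _)
  ∑-++ f (x ∷ xs) ys = trans (cong (λ s → f x + s) (∑-++ f xs ys)) (sym (ℤ.+-assoc (f x) _ _))

  ∑-map : {B : Set} (f : B → ℤ) (g : A → B) (xs : List A) →
          ∑[ y ∈ map g xs ] f y ≡ ∑[ x ∈ xs ] f (g x)
  ∑-map f g []       = refl
  ∑-map f g (x ∷ xs) = cong (λ s → f (g x) + s) (∑-map f g xs)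

  ∑-neg : (f : A → ℤ) (xs : List A) → ∑[ x ∈ xs ] (- f x) ≡ - ∑[ x ∈ xs ] f x
  ∑-neg f []       = refl
  ∑-neg f (x ∷ xs) = trans (cong (λ s → - f x + s) (∑-neg f xs)) (sym (ℤ.neg-distrib-+ (f x) _))

  *-distribˡ-∑ : (a : ℤ) (f : A → ℤ) (xs : List A) → a * ∑[ x ∈ xs ] f x ≡ ∑[ x ∈ xs ] (a * f x)
  *-distribˡ-∑ a f []       = ℤ.*-zeroʳ a
  *-distribˡ-∑ a f (x ∷ xs) =
    trans (ℤ.*-distribˡ-+ a (f x) _) (cong (λ s → a * f x + s) (*-distribˡ-∑ a f xs))

  ∑-one : (xs : List A) → ∑[ x ∈ xs ] 1ℤ ≡ + length xs
  ∑-one []       = refl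
  ∑-one (x ∷ xs) = cong (λ s → 1ℤ + s) (∑-one xs)

  ∑-sum-comm : (xs : List A) (f : A → Fin n → ℤ) →
               ∑[ x ∈ xs ] ∑[ j < n ] f x j ≡ ∑[ j < n ] ∑[ x ∈ xs ] f x j
  ∑-sum-comm {n} []       f = sym (sum-replicate-zero n)
  ∑-sum-comm     (x ∷ xs) f =
    trans (cong (λ s → sum (f x) + s) (∑-sum-comm xs f)) (sym (∑-distrib-+ (f x) _))

  ∑-nonneg : {f : A → ℤ} {xs : List A} → All (λ x → 0ℤ ℤ.≤ f x) xs → 0ℤ ℤ.≤ ∑[ x ∈ xs ] f x
  ∑-nonneg []          = ℤ.≤-refl
  ∑-nonneg (0≤fx ∷ p) = ℤ.+-mono-≤ 0≤fx (∑-nonneg p)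

  ∑-nonneg-zero : {f : A → ℤ} {xs : List A} → All (λ x → 0ℤ ℤ.≤ f x) xs →
                  ∑[ x ∈ xs ] f x ≡ 0ℤ → All (λ x → f x ≡ 0ℤ) xs
  ∑-nonneg-zero []                 _    = []
  ∑-nonneg-zero {f} {x ∷ xs} (0≤fx ∷ p) ∑≡0 = fx≡0 ∷ ∑-nonneg-zero p rest≡0
    where
    fx≡0 : f x ≡ 0ℤ
    fx≡0 = ℤ.≤-antisym
      (subst₂ ℤ._≤_ (ℤ.+-identityʳ (f x)) ∑≡0 (ℤ.+-monoʳ-≤ (f x) (∑-nonneg p))) 0≤fx
    rest≡0 : ∑[ y ∈ xs ] f y ≡ 0ℤ
    rest≡0 = trans (sym (ℤ.+-identityˡ _)) (trans (cong (_+ ∑[ y ∈ xs ] f y) (sym fx≡0)) ∑≡0)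

  ∑-nonneg-head : {f : A → ℤ} {y : A} {xs : List A} → All (λ x → 0ℤ ℤ.≤ f x) xs →
                  ∑[ x ∈ y ∷ xs ] f x ≡ f y → All (λ x → f x ≡ 0ℤ) xs
  ∑-nonneg-head {f} {y} {xs} nonneg ∑≡fy =
    ∑-nonneg-zero nonneg (identityʳ-unique (f y) (∑[ x ∈ xs ] f x) ∑≡fy)

δ : ℕ → ℕ → ℤ
δ w v = if w ℕ.≡ᵇ v then 1ℤ else 0ℤ

length-filter-≟ : {A : Set} (f : A → ℕ) (v : ℕ) (xs : List A) →
                  + length (filter (λ x → f x ℕ.≟ v) xs) ≡ ∑[ x ∈ xs ] δ (f x) v
length-filter-≟ f v []       = refl
length-filter-≟ f v (x ∷ xs) with f x ℕ.≡ᵇ v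
... | true  = cong (λ s → 1ℤ + s) (length-filter-≟ f v xs)
... | false = trans (length-filter-≟ f v xs) (sym (ℤ.+-identityˡ _))

sum-zero : (f : Fin n → ℤ) → (∀ j → f j ≡ 0ℤ) → ∑[ j < n ] f j ≡ 0ℤ
sum-zero {n} f f≡0 = trans (sum-cong-≗ f≡0) (sum-replicate-zero n)

sum-const : ∀ n a → ∑[ j < n ] (+ a) ≡ + (n ℕ.* a)
sum-const zero    a = refl
sum-const (suc n) a = cong (λ s → + a + s) (sum-const n a)

sum-δ : (j : Fin n) (f : Fin n → ℤ) → (∀ l → j ≢ l → f l ≡ 0ℤ) → ∑[ l < n ] f l ≡ f j
sum-δ {suc n} j f f≡0 = begin
  sum f                       ≡⟨ sum-remove {i = j} f ⟩
  f j + sum (f ∘ punchIn j)   ≡⟨ cong (λ s → f j + s) (sum-zero _ λ l → f≡0 (punchIn j l) (off l)) ⟩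
  f j + 0ℤ                    ≡⟨ ℤ.+-identityʳ (f j) ⟩
  f j                         ∎
  where
  off : ∀ l → j ≢ punchIn j l
  off l = ≢-sym (punchInᵢ≢i j l)

sum-*-sum : (f g : Fin n → ℤ) → sum f * sum g ≡ ∑[ j < n ] ∑[ l < n ] (f j * g l)
sum-*-sum f g = trans (*-distribʳ-sum (sum g) f) (sum-cong-≗ λ j → *-distribˡ-sum (f j) g)

record Cubic : Set where
  constructor cubic
  field c₃ c₂ c₁ c₀ : ℤ

open Cubic

eval : Cubic → ℤ → ℤ
eval p u = c₃ p * (u * u * u) + c₂ p * (u * u) + c₁ p * u + c₀ p

∑-eval : {A : Set} (p : Cubic) (f : A → ℤ) (xs : List A) →
         ∑[ x ∈ xs ] eval p (f x)
           ≡ c₃ p * ∑[ x ∈ xs ] (f x * f x * f x) + c₂ p * ∑[ x ∈ xs ] (f x * f x)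
             + c₁ p * ∑[ x ∈ xs ] f x + c₀ p * + length xs
∑-eval p f []       = sym (vanish (c₃ p) (c₂ p) (c₁ p) (c₀ p))
  where
  vanish : ∀ a b c d → a * 0ℤ + b * 0ℤ + c * 0ℤ + d * 0ℤ ≡ 0ℤ
  vanish = solve-∀
∑-eval p f (x ∷ xs) =
  trans (cong (λ s → eval p (f x) + s) (∑-eval p f xs))
        (step (c₃ p) (c₂ p) (c₁ p) (c₀ p) (f x) _ _ _ (+ length xs))
  where
  step : ∀ a b c d u s₃ s₂ s₁ l →
         (a * (u * u * u) + b * (u * u) + c * u + d) + (a * s₃ + b * s₂ + c * s₁ + d * l)
           ≡ a * (u * u * u + s₃) + b * (u * u + s₂) + c * (u + s₁) + d * (1ℤ + l)
  step = solve-∀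

-- Character sums over F₂ᵏ

χ : Bool → ℤ
χ false = 1ℤ
χ true  = -1ℤ

χ-xor : ∀ a b → χ (a xor b) ≡ χ a * χ b
χ-xor true  true  = refl
χ-xor true  false = refl
χ-xor false true  = refl
χ-xor false false = refl

χ-not : ∀ a → χ (not a) ≡ - χ a
χ-not true  = refl
χ-not false = refl

χ-·-⊕ : (x y c : Word n) → χ (x · c) * χ (y · c) ≡ χ ((x ⊕ y) · c)
χ-·-⊕ x y c = trans (sym (χ-xor (x · c) (y · c))) (cong χ (sym (·-distribʳ-⊕ x y c)))

length-allWords : ∀ k → length (allWords k) ≡ 2 ℕ.^ k
length-allWords zero    = refl
length-allWords (suc k) = begin
  length (map (false ∷_) W ++ map (true ∷_) W)
    ≡⟨ length-++ (map (false ∷_) W) ⟩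
  length (map (false ∷_) W) ℕ.+ length (map (true ∷_) W)
    ≡⟨ cong₂ ℕ._+_ (length-map _ W) (length-map _ W) ⟩
  length W ℕ.+ length W
    ≡⟨ cong (λ l → l ℕ.+ l) (length-allWords k) ⟩
  2 ℕ.^ k ℕ.+ 2 ℕ.^ k
    ≡⟨ cong (2 ℕ.^ k ℕ.+_) (sym (ℕ.+-identityʳ _)) ⟩
  2 ℕ.^ suc k
    ∎
  where W = allWords k

allWords-zero-first : ∀ k → ∃ λ ms → allWords k ≡ 0w k ∷ ms
allWords-zero-first zero = [] , refl
allWords-zero-first (suc k) with allWords-zero-first k
... | ms , eq rewrite eq = map (false ∷_) ms ++ map (true ∷_) (0w k ∷ ms) , refl

∑-allWords-suc : (f : Word (suc k) → ℤ) →
  ∑[ m ∈ allWords (suc k) ] f m ≡ ∑[ m ∈ allWords k ] f (false ∷ m) + ∑[ m ∈ allWords k ] f (true ∷ m)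
∑-allWords-suc {k} f = trans (∑-++ f (map (false ∷_) W) (map (true ∷_) W))
                            (cong₂ _+_ (∑-map f (false ∷_) W) (∑-map f (true ∷_) W))
  where W = allWords k

∑-χ-· : (v : Word k) → v ≢ 0w k → ∑[ m ∈ allWords k ] χ (m · v) ≡ 0ℤ
∑-χ-· []          v≢0 = contradiction refl v≢0
∑-χ-· (false ∷ v) v≢0 = trans (∑-allWords-suc (λ m → χ (m · (false ∷ v))))
                               (cong₂ _+_ IH IH)
  where IH = ∑-χ-· v (v≢0 ∘ cong (false ∷_))
∑-χ-· {suc k} (true ∷ v) _ = begin
  ∑[ m ∈ allWords (suc k) ] χ (m · (true ∷ v))
    ≡⟨ ∑-allWords-suc (λ m → χ (m · (true ∷ v))) ⟩
  S + ∑[ m ∈ allWords k ] χ (not (m · v))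
    ≡⟨ cong (λ s → S + s) (∑-cong (allWords k) (χ-not ∘ (_· v))) ⟩
  S + ∑[ m ∈ allWords k ] (- χ (m · v))
    ≡⟨ cong (λ s → S + s) (∑-neg (λ m → χ (m · v)) (allWords k)) ⟩
  S - S
    ≡⟨ ℤ.+-inverseʳ S ⟩
  0ℤ
    ∎
  where S = ∑[ m ∈ allWords k ] χ (m · v)

module _ (G : Generator k n) where

  ∑-χ-0w·encode : ∑[ m ∈ allWords k ] χ (0w n · encode G m) ≡ + 2 ℕ.^ k
  ∑-χ-0w·encode = begin
    ∑[ m ∈ allWords k ] χ (0w n · encode G m)   ≡⟨ ∑-cong (allWords k) (cong χ ∘ ·-zeroˡ ∘ encode G) ⟩
    ∑[ m ∈ allWords k ] 1ℤ                      ≡⟨ ∑-one (allWords k) ⟩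
    + length (allWords k)                       ≡⟨ cong +_ (length-allWords k) ⟩
    + 2 ℕ.^ k                                   ∎

  ∑-χ-·encode : (x : Word n) → syndrome G x ≢ 0w k → ∑[ m ∈ allWords k ] χ (x · encode G m) ≡ 0ℤ
  ∑-χ-·encode x Gx≢0 =
    trans (∑-cong (allWords k) (cong χ ∘ ·-encode G x)) (∑-χ-· (syndrome G x) Gx≢0)

bias : Word n → ℤ
bias {n} c = ∑[ j < n ] χ (lookup c j)

bias-wt : (c : Word n) → bias c ≡ + n - + 2 * + wt c
bias-wt []                  = refl
bias-wt {suc n} (true ∷ c)  = trans (cong (λ s → -1ℤ + s) (bias-wt c)) (shift (+ n) (+ wt c))
  where
  shift : ∀ m w → -1ℤ + (m - + 2 * w) ≡ (+ 1 + m) - + 2 * (+ 1 + w)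
  shift = solve-∀
bias-wt {suc n} (false ∷ c) = trans (cong (λ s → 1ℤ + s) (bias-wt c)) (shift (+ n) (+ wt c))
  where
  shift : ∀ m w → 1ℤ + (m - + 2 * w) ≡ (+ 1 + m) - + 2 * w
  shift = solve-∀

bias-e : (c : Word n) → bias c ≡ ∑[ j < n ] χ (e j · c)
bias-e c = sum-cong-≗ λ j → cong χ (sym (e-· j c))

bias² : (c : Word n) → bias c * bias c ≡ ∑[ j < n ] ∑[ l < n ] χ ((e j ⊕ e l) · c)
bias² c = begin
  bias c * bias c
    ≡⟨ cong₂ _*_ (bias-e c) (bias-e c) ⟩
  sum (λ j → χ (e j · c)) * sum (λ l → χ (e l · c))
    ≡⟨ sum-*-sum (λ j → χ (e j · c)) (λ l → χ (e l · c)) ⟩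
  ∑[ j < _ ] ∑[ l < _ ] (χ (e j · c) * χ (e l · c))
    ≡⟨ sum-cong-≗ (λ j → sum-cong-≗ λ l → χ-·-⊕ (e j) (e l) c) ⟩
  ∑[ j < _ ] ∑[ l < _ ] χ ((e j ⊕ e l) · c)
    ∎

bias³ : (c : Word n) →
        bias c * bias c * bias c ≡ ∑[ j < n ] ∑[ l < n ] ∑[ i < n ] χ (((e j ⊕ e l) ⊕ e i) · c)
bias³ c = begin
  bias c * bias c * bias c
    ≡⟨ cong₂ _*_ (bias² c) (bias-e c) ⟩
  sum (λ j → ∑[ l < _ ] χ ((e j ⊕ e l) · c)) * sum (λ i → χ (e i · c))
    ≡⟨ *-distribʳ-sum (sum (λ i → χ (e i · c))) (λ j → sum (λ l → χ ((e j ⊕ e l) · c))) ⟩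
  ∑[ j < _ ] (sum (λ l → χ ((e j ⊕ e l) · c)) * sum (λ i → χ (e i · c)))
    ≡⟨ sum-cong-≗ (λ j → sum-*-sum (λ l → χ ((e j ⊕ e l) · c)) (λ i → χ (e i · c))) ⟩
  ∑[ j < _ ] ∑[ l < _ ] ∑[ i < _ ] (χ ((e j ⊕ e l) · c) * χ (e i · c))
    ≡⟨ sum-cong-≗ (λ j → sum-cong-≗ λ l → sum-cong-≗ λ i → χ-·-⊕ (e j ⊕ e l) (e i) c) ⟩
  ∑[ j < _ ] ∑[ l < _ ] ∑[ i < _ ] χ (((e j ⊕ e l) ⊕ e i) · c)
    ∎

-- Power moments of the bias

module PowerMoments (G : Generator k n)
  (dual-distance : ∀ x → x ∈C⊥ G → x ≢ 0w n → 4 ≤ wt x) where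

  ∑-χ-light : (x : Word n) → x ≢ 0w n → wt x ≤ 3 → ∑[ m ∈ allWords k ] χ (x · encode G m) ≡ 0ℤ
  ∑-χ-light x x≢0 wt≤3 = ∑-χ-·encode G x λ Gx≡0 →
    contradiction (ℕ.≤-trans (dual-distance x (syndrome≡0⇒∈C⊥ G x Gx≡0) x≢0) wt≤3) (ℕ.<⇒≱ (ℕ.n<1+n 3))

  ∑-bias : ∑[ m ∈ allWords k ] bias (encode G m) ≡ 0ℤ
  ∑-bias = begin
    ∑[ m ∈ allWords k ] bias (encode G m)
      ≡⟨ ∑-cong (allWords k) (bias-e ∘ encode G) ⟩
    ∑[ m ∈ allWords k ] ∑[ j < n ] χ (e j · encode G m)
      ≡⟨ ∑-sum-comm (allWords k) (λ m j → χ (e j · encode G m)) ⟩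
    ∑[ j < n ] ∑[ m ∈ allWords k ] χ (e j · encode G m)
      ≡⟨ sum-zero _ (λ j → ∑-χ-light (e j) (e≢0 j) (subst (_≤ 3) (sym (wt-e j)) (ℕ.s≤s ℕ.z≤n))) ⟩
    0ℤ
      ∎

  ∑-bias² : ∑[ m ∈ allWords k ] (bias (encode G m) * bias (encode G m)) ≡ + (n ℕ.* 2 ℕ.^ k)
  ∑-bias² = begin
    ∑[ m ∈ allWords k ] (bias (encode G m) * bias (encode G m))
      ≡⟨ ∑-cong (allWords k) (bias² ∘ encode G) ⟩
    ∑[ m ∈ allWords k ] ∑[ j < n ] ∑[ l < n ] χ ((e j ⊕ e l) · encode G m)
      ≡⟨ ∑-sum-comm (allWords k) (λ m j → ∑[ l < n ] χ ((e j ⊕ e l) · encode G m)) ⟩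
    ∑[ j < n ] ∑[ m ∈ allWords k ] ∑[ l < n ] χ ((e j ⊕ e l) · encode G m)
      ≡⟨ sum-cong-≗ (λ j → ∑-sum-comm (allWords k) (λ m l → χ ((e j ⊕ e l) · encode G m))) ⟩
    ∑[ j < n ] ∑[ l < n ] ∑[ m ∈ allWords k ] χ ((e j ⊕ e l) · encode G m)
      ≡⟨ sum-cong-≗ (λ j → sum-δ j _ λ l j≢l →
           ∑-χ-light (e j ⊕ e l) (e⊕e≢0 j≢l) (ℕ.≤-trans (wt-e⊕e j l) (ℕ.n≤1+n 2))) ⟩
    ∑[ j < n ] ∑[ m ∈ allWords k ] χ ((e j ⊕ e j) · encode G m)
      ≡⟨ sum-cong-≗ (λ j → trans (∑-cong (allWords k) λ m → cong (λ x → χ (x · encode G m)) (⊕-self (e j)))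
                                  (∑-χ-0w·encode G)) ⟩
    ∑[ j < n ] (+ 2 ℕ.^ k)
      ≡⟨ sum-const n (2 ℕ.^ k) ⟩
    + (n ℕ.* 2 ℕ.^ k)
      ∎

  ∑-bias³ : ∑[ m ∈ allWords k ] (bias (encode G m) * bias (encode G m) * bias (encode G m)) ≡ 0ℤ
  ∑-bias³ = begin
    ∑[ m ∈ allWords k ] (bias (encode G m) * bias (encode G m) * bias (encode G m))
      ≡⟨ ∑-cong (allWords k) (bias³ ∘ encode G) ⟩
    ∑[ m ∈ allWords k ] ∑[ j < n ] ∑[ l < n ] ∑[ i < n ] χ (((e j ⊕ e l) ⊕ e i) · encode G m)
      ≡⟨ ∑-sum-comm (allWords k) (λ m j → ∑[ l < n ] ∑[ i < n ] χ (((e j ⊕ e l) ⊕ e i) · encode G m)) ⟩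
    ∑[ j < n ] ∑[ m ∈ allWords k ] ∑[ l < n ] ∑[ i < n ] χ (((e j ⊕ e l) ⊕ e i) · encode G m)
      ≡⟨ sum-cong-≗ (λ j →
           ∑-sum-comm (allWords k) (λ m l → ∑[ i < n ] χ (((e j ⊕ e l) ⊕ e i) · encode G m))) ⟩
    ∑[ j < n ] ∑[ l < n ] ∑[ m ∈ allWords k ] ∑[ i < n ] χ (((e j ⊕ e l) ⊕ e i) · encode G m)
      ≡⟨ sum-cong-≗ (λ j → sum-cong-≗ λ l →
           ∑-sum-comm (allWords k) (λ m i → χ (((e j ⊕ e l) ⊕ e i) · encode G m))) ⟩
    ∑[ j < n ] ∑[ l < n ] ∑[ i < n ] ∑[ m ∈ allWords k ] χ (((e j ⊕ e l) ⊕ e i) · encode G m)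
      ≡⟨ sum-zero _ (λ j → sum-zero _ λ l → sum-zero _ λ i →
           ∑-χ-light _ (e⊕e⊕e≢0 j l i) (wt-e⊕e⊕e j l i)) ⟩
    0ℤ
      ∎

-- The [36, 7] case

spectrum candidates : List ℕ
spectrum   = 0 ∷ 16 ∷ 20 ∷ 36 ∷ []
candidates = 0 ∷ 16 ∷ 20 ∷ 24 ∷ 28 ∷ 32 ∷ 36 ∷ []

biasOf : ℕ → ℤ
biasOf w = + 36 - + 2 * + w

-- 92160 times the Lagrange basis polynomial of the node biasOf v, for the nodes biasOf w =
-- 36, 4, -4, -36 (w ∈ spectrum); e.g. eval (ℓ 0) u = P(u) = (u + 36)(u - 4)(u + 4).
ℓ : ℕ → Cubic
ℓ v =
  if v ℕ.≡ᵇ 0  then cubic (+ 1) (+ 36) (- + 16) (- + 576) else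
  if v ℕ.≡ᵇ 16 then cubic (- + 9) (- + 36) (+ 11664) (+ 46656) else
  if v ℕ.≡ᵇ 20 then cubic (+ 9) (- + 36) (- + 11664) (+ 46656) else
  if v ℕ.≡ᵇ 36 then cubic (- + 1) (+ 36) (+ 16) (- + 576) else
  cubic 0ℤ 0ℤ 0ℤ 0ℤ

ℓ-interpolates : All (λ v → All (λ w → eval (ℓ v) (biasOf w) ≡ + 92160 * δ w v) spectrum) spectrum
ℓ-interpolates = from-yes (All.all? (λ v → All.all? (λ w → eval (ℓ v) (biasOf w) ℤ.≟ + 92160 * δ w v)
                                                    spectrum) spectrum)

ℓ-moments : All (λ v → c₃ (ℓ v) * 0ℤ + c₂ (ℓ v) * + 4608 + c₁ (ℓ v) * 0ℤ + c₀ (ℓ v) * + 128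
                        ≡ + 92160 * + targetCoeff v) spectrum
ℓ-moments = from-yes (All.all? (λ v →
  c₃ (ℓ v) * 0ℤ + c₂ (ℓ v) * + 4608 + c₁ (ℓ v) * 0ℤ + c₀ (ℓ v) * + 128 ℤ.≟ + 92160 * + targetCoeff v) spectrum)

ℓ₀-nonneg : All (λ w → 0ℤ ℤ.≤ eval (ℓ 0) (biasOf w)) candidates
ℓ₀-nonneg = from-yes (All.all? (λ w → 0ℤ ℤ.≤? eval (ℓ 0) (biasOf w)) candidates)

ℓ₀-zeros : All (λ w → eval (ℓ 0) (biasOf w) ≡ 0ℤ → w ∈ spectrum) candidates
ℓ₀-zeros = from-yes (All.all? (λ w → (eval (ℓ 0) (biasOf w) ℤ.≟ 0ℤ) →-dec (w ∈? spectrum)) candidates)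

candidate-weight : ∀ {w} → w ≤ 36 → 4 ∣ w → 16 ≤ w → w ∈ candidates
candidate-weight w≤36 = subst Candidate (toℕ-fromℕ< (ℕ.s≤s w≤36)) (check (fromℕ< (ℕ.s≤s w≤36)))
  where
  Candidate : ℕ → Set
  Candidate w = 4 ∣ w → 16 ≤ w → w ∈ candidates
  check : (v : Fin 37) → Candidate (toℕ v)
  check = from-yes (Fin.all? {37} λ v → (4 ∣? toℕ v) →-dec ((16 ℕ.≤? toℕ v) →-dec (toℕ v ∈? candidates)))

≡ᵇ-false : {m n : ℕ} → m ≢ n → (m ℕ.≡ᵇ n) ≡ false
≡ᵇ-false {m} {n} = dec-false (m ℕ.≟ n)

targetCoeff-outside : ∀ {v} → v ∉ spectrum → targetCoeff v ≡ 0
targetCoeff-outside v∉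
  rewrite ≡ᵇ-false (v∉ ∘ here) | ≡ᵇ-false (v∉ ∘ there ∘ here)
        | ≡ᵇ-false (v∉ ∘ there ∘ there ∘ here) | ≡ᵇ-false (v∉ ∘ there ∘ there ∘ there ∘ here) = refl

module WeightEnumerator (G : Generator 7 36)
  (doubly-even : ∀ c → c ∈C G → 4 ∣ wt c)
  (min-weight : ∀ c → c ∈C G → c ≢ 0w 36 → 16 ≤ wt c)
  (dual-distance : ∀ x → x ∈C⊥ G → x ≢ 0w 36 → 4 ≤ wt x) where

  open PowerMoments G dual-distance

  codeword-weight : ∀ m → wt (encode G m) ∈ candidates
  codeword-weight m with Vec.≡-dec Bool._≟_ (encode G m) (0w 36)
  ... | yes c≡0 = here (trans (cong wt c≡0) (wt-0w 36))
  ... | no  c≢0 =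
    candidate-weight (wt-≤ (encode G m)) (doubly-even _ (m , refl)) (min-weight _ (m , refl) c≢0)

  ∑-eval-bias : (p : Cubic) →
                ∑[ m ∈ allWords 7 ] eval p (bias (encode G m))
                  ≡ c₃ p * 0ℤ + c₂ p * + 4608 + c₁ p * 0ℤ + c₀ p * + 128
  ∑-eval-bias p = trans (∑-eval p (bias ∘ encode G) (allWords 7))
    (cong₂ _+_ (cong₂ _+_ (cong₂ _+_ (cong (c₃ p *_) ∑-bias³) (cong (c₂ p *_) ∑-bias²))
                          (cong (c₁ p *_) ∑-bias))
               refl)

  ℓ₀-bias-nonneg : ∀ m → 0ℤ ℤ.≤ eval (ℓ 0) (bias (encode G m))
  ℓ₀-bias-nonneg m = subst (λ u → 0ℤ ℤ.≤ eval (ℓ 0) u) (sym (bias-wt (encode G m)))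
                           (All.lookup ℓ₀-nonneg (codeword-weight m))

  ℓ₀-bias-zero : ∀ m → eval (ℓ 0) (bias (encode G m)) ≡ 0ℤ → wt (encode G m) ∈ spectrum
  ℓ₀-bias-zero m ℓ₀≡0 = All.lookup ℓ₀-zeros (codeword-weight m)
    (trans (cong (eval (ℓ 0)) (sym (bias-wt (encode G m)))) ℓ₀≡0)

  ℓ₀-bias-0w : eval (ℓ 0) (bias (encode G (0w 7))) ≡ + 92160
  ℓ₀-bias-0w = cong (eval (ℓ 0) ∘ bias) (encode-0 G)

  weights-in-spectrum : All (λ m → wt (encode G m) ∈ spectrum) (allWords 7)
  weights-in-spectrum with allWords-zero-first 7
  ... | ms , eq = subst (All _) (sym eq) (zero-weight ∷ All.map (λ {m} → ℓ₀-bias-zero m) rest-zero)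
    where
    zero-weight : wt (encode G (0w 7)) ∈ spectrum
    zero-weight = here (trans (cong wt (encode-0 G)) (wt-0w 36))
    rest-zero : All (λ m → eval (ℓ 0) (bias (encode G m)) ≡ 0ℤ) ms
    rest-zero = ∑-nonneg-head (All.tabulate λ {m} _ → ℓ₀-bias-nonneg m)
      (subst (λ ws → ∑[ m ∈ ws ] eval (ℓ 0) (bias (encode G m)) ≡ eval (ℓ 0) (bias (encode G (0w 7)))) eq
             (trans (∑-eval-bias (ℓ 0)) (sym ℓ₀-bias-0w)))

  count-spectrum : ∀ {v} → v ∈ spectrum → weightEnumCoeff G v ≡ targetCoeff v
  count-spectrum {v} v∈ = ℤ.+-injective (ℤ.*-cancelˡ-≡ (+ 92160) _ _ (begin
    + 92160 * + weightEnumCoeff G v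
      ≡⟨ cong (λ s → + 92160 * s) (length-filter-≟ (wt ∘ encode G) v (allWords 7)) ⟩
    + 92160 * ∑[ m ∈ allWords 7 ] δ (wt (encode G m)) v
      ≡⟨ *-distribˡ-∑ (+ 92160) (λ m → δ (wt (encode G m)) v) (allWords 7) ⟩
    ∑[ m ∈ allWords 7 ] (+ 92160 * δ (wt (encode G m)) v)
      ≡⟨ ∑-cong-All (All.map (λ {m} w∈ → trans (sym (All.lookup (All.lookup ℓ-interpolates v∈) w∈))
                                               (cong (eval (ℓ v)) (sym (bias-wt (encode G m)))))
                             weights-in-spectrum) ⟩
    ∑[ m ∈ allWords 7 ] eval (ℓ v) (bias (encode G m))
      ≡⟨ ∑-eval-bias (ℓ v) ⟩
    c₃ (ℓ v) * 0ℤ + c₂ (ℓ v) * + 4608 + c₁ (ℓ v) * 0ℤ + c₀ (ℓ v) * + 128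
      ≡⟨ All.lookup ℓ-moments v∈ ⟩
    + 92160 * + targetCoeff v
      ∎))

  count-outside : ∀ {v} → v ∉ spectrum → weightEnumCoeff G v ≡ 0
  count-outside {v} v∉ = cong length (filter-none (λ m → wt (encode G m) ℕ.≟ v)
    (All.map (λ w∈ w≡v → v∉ (subst (_∈ spectrum) w≡v w∈)) weights-in-spectrum))

  weight-enumerator : ∀ i → weightEnumCoeff G i ≡ targetCoeff i
  weight-enumerator i with i ∈? spectrum
  ... | yes i∈ = count-spectrum i∈
  ... | no  i∉ = trans (count-outside i∉) (sym (targetCoeff-outside i∉))

lemma3p1 : (G : Generator 7 36) → LinIndep G
    → (∀ (c : Word 36) → c ∈C G → 4 ∣ wt c)
    → (∀ (c : Word 36) → c ∈C G → ¬ (c ≡ 0w 36) → 16 ≤ wt c)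
    → (∀ (x : Word 36) → (∀ (c : Word 36) → c ∈C G → x · c ≡ false) → ¬ (x ≡ 0w 36) → 4 ≤ wt x)
    → ∀ (i : ℕ) → weightEnumCoeff G i ≡ targetCoeff i
lemma3p1 G _ doubly-even min-weight dual-distance =
  WeightEnumerator.weight-enumerator G doubly-even min-weight dual-distance
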